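{- Let $G$ be a finite group with identity $e$, let $S\subseteq G\setminus\{e\}$ with $S=S^{ -1}$, and suppose the Cayley graph $\Gamma=\mathrm{Cay}(G,S)$ is a Neumaier graph with parameters $(n,k,\lambda;a,c)$ having a regular clique $C$ with $e\in C$, $|C|=c$ and nexus $a$. Then $\Gamma$ is strongly regular if and only if all vertices in $G\setminus(S\cup\{e\})$ have the same number of neighbours in $S\setminus C$.
   Context: All graphs are finite, undirected and simple. The Cayley graph $\mathrm{Cay}(G,S)$ has vertex set $G$, with $x\sim y$ iff $xy^{ -1}\in S$. A $k$-regular graph on $n$ vertices is edge-regular with parameters $(n,k,\lambda)$ if every two adjacent vertices have exactly $\lambda$ common neighbours. A clique $C$ is regular with nexus $a$ (here $a\ge 1$) if every vertex outside $C$ is adjacent to exactly $a$ vertices of $C$. A Neumaier graph is a non-complete edge-regular graph with a regular clique; its parameters $(n,k,\lambda;a,c)$ record the edge-regular parameters, the nexus $a$ and the clique size $c$. A strongly regular graph with parameters $(n,k,\lambda,\mu)$ is a $k$-regular graph on $n$ vertices in which adjacent vertices have $\lambda$ and distinct non-adjacent vertices have $\mu$ common neighbours. -}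

module Defs where

open import Data.Nat using (ℕ; _≥_)
open import Data.Bool using (Bool; true; false)
open import Data.Fin using (Fin)
open import Data.Fin.Subset using (Subset; _∈_; _∉_; ∣_∣; _∩_)
open import Data.Vec using (lookup; tabulate)
open import Data.Product using (Σ; ∃; _×_)
open import Relation.Binary.PropositionalEquality using (_≡_; _≢_)
open import Relation.Nullary using (¬_)
open import Algebra.Structures using (IsGroup)

-- A finite group of order n: a group structure on Fin n with
-- propositional equality (every finite group is isomorphic to one of these).
record FinGroup (n : ℕ) : Set where
  field
    _·_     : Fin n → Fin n → Fin n
    e       : Fin n
    _⁻¹     : Fin n → Fin n
    isGroup : IsGroup _≡_ _·_ e _⁻¹

Graph : ℕ → Set
Graph n = Fin n → Fin n → Bool

module _ {n : ℕ} where

  Adj : Graph n → Fin n → Fin n → Set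
  Adj Γ x y = Γ x y ≡ true

  N : Graph n → Fin n → Subset n
  N Γ x = tabulate (Γ x)

  Cay : FinGroup n → Subset n → Graph n
  Cay G S x y = lookup S (x · (y ⁻¹))
    where open FinGroup G

  IsRegular : Graph n → ℕ → Set
  IsRegular Γ k = ∀ x → ∣ N Γ x ∣ ≡ k

  IsEdgeRegular : Graph n → ℕ → ℕ → Set
  IsEdgeRegular Γ k l =
    IsRegular Γ k × (∀ x y → Adj Γ x y → ∣ N Γ x ∩ N Γ y ∣ ≡ l)

  IsComplete : Graph n → Set
  IsComplete Γ = ∀ x y → x ≢ y → Adj Γ x y

  IsClique : Graph n → Subset n → Set
  IsClique Γ C = ∀ x y → x ∈ C → y ∈ C → x ≢ y → Adj Γ x y

  IsRegularClique : Graph n → Subset n → ℕ → Set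
  IsRegularClique Γ C a =
    IsClique Γ C × a ≥ 1 × (∀ x → x ∉ C → ∣ N Γ x ∩ C ∣ ≡ a)

  IsSRGWith : Graph n → ℕ → ℕ → ℕ → Set
  IsSRGWith Γ k l μ =
    IsRegular Γ k
    × (∀ x y → Adj Γ x y → ∣ N Γ x ∩ N Γ y ∣ ≡ l)
    × (∀ x y → x ≢ y → ¬ Adj Γ x y → ∣ N Γ x ∩ N Γ y ∣ ≡ μ)

  IsStronglyRegular : Graph n → Set
  IsStronglyRegular Γ = ∃ λ k → ∃ λ l → ∃ λ μ → IsSRGWith Γ k l μ

module Submission where

-- If C is a regular clique with nexus a, v ∈ C, and x ≠ v is not adjacent to v,
-- then x ∉ C and N(x) ∩ C ⊆ N(v), so x and v have exactly a + |N(x) ∩ (N(v) ∖ C)|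
-- common neighbours. In Cay(G,S) right translations are automorphisms and N(e) = S,
-- so a non-adjacent pair x ≠ y has a + |N(xy⁻¹) ∩ (S ∖ C)| common neighbours, and
-- xy⁻¹ ranges over G ∖ (S ∪ {e}).

open import Defs
open import Data.Nat using (ℕ; suc; _+_; _∸_)
open import Data.Nat.Properties using (+-0-commutativeMonoid; +-suc; m+n∸m≡n)
open import Data.Bool using (_∧_)
open import Data.Fin using (Fin)
open import Data.Fin.Subset using (Subset; Side; inside; outside; _∈_; _∉_; _⊆_; ∣_∣; _∩_; _∪_; _─_; ⁅_⁆)
open import Data.Fin.Subset.Properties using (drop-∷-⊆; ⊆-antisym; x∈p∩q⁻; x∈p∪q⁺; x∈p∪q⁻; x∈⁅x⁆; x∈⁅y⁆⇒x≡y)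
open import Data.Fin.Permutation using (Permutation′; permutation; _⟨$⟩ʳ_)
open import Data.Vec using ([]; _∷_; here; lookup)
open import Data.Vec.Properties using ([]=⇒lookup; lookup⇒[]=; lookup-zipWith; lookup∘tabulate)
open import Data.Product using (∃; _,_)
open import Data.Sum using (inj₁; inj₂; [_,_]′)
open import Function.Base using (_∘_)
open import Function.Bundles using (_⇔_; mk⇔)
open import Relation.Binary.PropositionalEquality using (_≡_; _≢_; refl; sym; trans; cong; cong₂; subst; module ≡-Reasoning)
open import Relation.Nullary using (¬_; contradiction)
open import Algebra.Bundles using (Group)
import Algebra.Properties.Group as GroupProperties
import Algebra.Properties.CommutativeMonoid.Sum as Sum

open Sum +-0-commutativeMonoid using (sum; sum-cong-≗; sum-permute)

𝟙 : Side → ℕ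
𝟙 inside  = 1
𝟙 outside = 0

∣p∣≡sum𝟙 : ∀ {n} (p : Subset n) → ∣ p ∣ ≡ sum (𝟙 ∘ lookup p)
∣p∣≡sum𝟙 []            = refl
∣p∣≡sum𝟙 (inside  ∷ p) = cong suc (∣p∣≡sum𝟙 p)
∣p∣≡sum𝟙 (outside ∷ p) = ∣p∣≡sum𝟙 p

∣∣-permute : ∀ {n} (p q : Subset n) (π : Permutation′ n)
  → (∀ i → lookup p (π ⟨$⟩ʳ i) ≡ lookup q i) → ∣ p ∣ ≡ ∣ q ∣
∣∣-permute p q π p∘π≗q = begin
  ∣ p ∣                          ≡⟨ ∣p∣≡sum𝟙 p ⟩
  sum (𝟙 ∘ lookup p)             ≡⟨ sum-permute (𝟙 ∘ lookup p) π ⟩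
  sum (𝟙 ∘ lookup p ∘ (π ⟨$⟩ʳ_)) ≡⟨ sum-cong-≗ (cong 𝟙 ∘ p∘π≗q) ⟩
  sum (𝟙 ∘ lookup q)             ≡⟨ ∣p∣≡sum𝟙 q ⟨
  ∣ q ∣                          ∎
  where open ≡-Reasoning

∣p∩q∣≡∣p∩r∣+∣p∩[q─r]∣ : ∀ {n} (p q r : Subset n)
  → p ∩ r ⊆ q → ∣ p ∩ q ∣ ≡ ∣ p ∩ r ∣ + ∣ p ∩ (q ─ r) ∣
∣p∩q∣≡∣p∩r∣+∣p∩[q─r]∣ [] [] [] _ = refl
∣p∩q∣≡∣p∩r∣+∣p∩[q─r]∣ (outside ∷ p) (_ ∷ q) (_ ∷ r) p∩r⊆q =
  ∣p∩q∣≡∣p∩r∣+∣p∩[q─r]∣ p q r (drop-∷-⊆ p∩r⊆q)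
∣p∩q∣≡∣p∩r∣+∣p∩[q─r]∣ (inside ∷ p) (inside ∷ q) (inside ∷ r) p∩r⊆q =
  cong suc (∣p∩q∣≡∣p∩r∣+∣p∩[q─r]∣ p q r (drop-∷-⊆ p∩r⊆q))
∣p∩q∣≡∣p∩r∣+∣p∩[q─r]∣ (inside ∷ p) (inside ∷ q) (outside ∷ r) p∩r⊆q =
  trans (cong suc (∣p∩q∣≡∣p∩r∣+∣p∩[q─r]∣ p q r (drop-∷-⊆ p∩r⊆q))) (sym (+-suc _ _))
∣p∩q∣≡∣p∩r∣+∣p∩[q─r]∣ (inside ∷ p) (outside ∷ q) (inside ∷ r) p∩r⊆q =
  contradiction (p∩r⊆q here) λ ()
∣p∩q∣≡∣p∩r∣+∣p∩[q─r]∣ (inside ∷ p) (outside ∷ q) (outside ∷ r) p∩r⊆q =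
  ∣p∩q∣≡∣p∩r∣+∣p∩[q─r]∣ p q r (drop-∷-⊆ p∩r⊆q)

module _ {n : ℕ} (Γ : Graph n) where

  ∈N⇒Adj : ∀ {x y} → y ∈ N Γ x → Adj Γ x y
  ∈N⇒Adj {x} {y} y∈Nx = trans (sym (lookup∘tabulate (Γ x) y)) ([]=⇒lookup y∈Nx)

  Adj⇒∈N : ∀ {x y} → Adj Γ x y → y ∈ N Γ x
  Adj⇒∈N {x} {y} adj = lookup⇒[]= y (N Γ x) (trans (lookup∘tabulate (Γ x) y) adj)

  IsAutomorphism : Permutation′ n → Set
  IsAutomorphism σ = ∀ x y → Γ (σ ⟨$⟩ʳ x) (σ ⟨$⟩ʳ y) ≡ Γ x y

  ∣N∩N∣-automorphism : ∀ σ → IsAutomorphism σ → ∀ x y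
    → ∣ N Γ (σ ⟨$⟩ʳ x) ∩ N Γ (σ ⟨$⟩ʳ y) ∣ ≡ ∣ N Γ x ∩ N Γ y ∣
  ∣N∩N∣-automorphism σ σ-auto x y =
    ∣∣-permute (N Γ (σ ⟨$⟩ʳ x) ∩ N Γ (σ ⟨$⟩ʳ y)) (N Γ x ∩ N Γ y) σ λ z → begin
    lookup (N Γ (σ ⟨$⟩ʳ x) ∩ N Γ (σ ⟨$⟩ʳ y)) (σ ⟨$⟩ʳ z)  ≡⟨ lookup-N∩N (σ ⟨$⟩ʳ x) (σ ⟨$⟩ʳ y) (σ ⟨$⟩ʳ z) ⟩
    Γ (σ ⟨$⟩ʳ x) (σ ⟨$⟩ʳ z) ∧ Γ (σ ⟨$⟩ʳ y) (σ ⟨$⟩ʳ z)     ≡⟨ cong₂ _∧_ (σ-auto x z) (σ-auto y z) ⟩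
    Γ x z ∧ Γ y z                                         ≡⟨ lookup-N∩N x y z ⟨
    lookup (N Γ x ∩ N Γ y) z                              ∎
    where
    open ≡-Reasoning
    lookup-N∩N : ∀ x y z → lookup (N Γ x ∩ N Γ y) z ≡ Γ x z ∧ Γ y z
    lookup-N∩N x y z = trans (lookup-zipWith _∧_ z (N Γ x) (N Γ y))
                             (cong₂ _∧_ (lookup∘tabulate (Γ x) z) (lookup∘tabulate (Γ y) z))

  ∣N∩N∣≡nexus+∣N∩[N─C]∣ : ∀ {C a x v}
    → IsRegularClique Γ C a → v ∈ C → x ≢ v → ¬ Adj Γ x v
    → ∣ N Γ x ∩ N Γ v ∣ ≡ a + ∣ N Γ x ∩ (N Γ v ─ C) ∣
  ∣N∩N∣≡nexus+∣N∩[N─C]∣ {C} {x = x} {v} (clique , _ , nexus) v∈C x≢v x≁v =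
    trans (∣p∩q∣≡∣p∩r∣+∣p∩[q─r]∣ (N Γ x) (N Γ v) C Nx∩C⊆Nv)
          (cong (_+ ∣ N Γ x ∩ (N Γ v ─ C) ∣) (nexus x x∉C))
    where
    x∉C : x ∉ C
    x∉C x∈C = x≁v (clique x v x∈C v∈C x≢v)
    Nx∩C⊆Nv : N Γ x ∩ C ⊆ N Γ v
    Nx∩C⊆Nv {z} z∈Nx∩C with x∈p∩q⁻ (N Γ x) C z∈Nx∩C
    ... | z∈Nx , z∈C = Adj⇒∈N (clique v z v∈C z∈C λ { refl → x≁v (∈N⇒Adj z∈Nx) })

module _ {n : ℕ} (G : FinGroup n) (S : Subset n) where
  open FinGroup G

  private
    group : Group _ _
    group = record { isGroup = isGroup }
    open Group group using (assoc; identityˡ; identityʳ)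
    open GroupProperties group
      using (ε⁻¹≈ε; ⁻¹-involutive; ⁻¹-anti-homo-∙; x∙y⁻¹≈ε⇒x≈y; //-rightDividesˡ; //-rightDividesʳ)

  Cay-adj-e : ∀ x → Cay G S x e ≡ lookup S x
  Cay-adj-e x = cong (lookup S) (trans (cong (x ·_) ε⁻¹≈ε) (identityʳ x))

  N-Cay-e : (∀ s → s ∈ S → s ⁻¹ ∈ S) → N (Cay G S) e ≡ S
  N-Cay-e S⁻¹⊆S = ⊆-antisym Ne⊆S S⊆Ne
    where
    e·z⁻¹∈S⇒z∈S : ∀ {z} → e · (z ⁻¹) ∈ S → z ∈ S
    e·z⁻¹∈S⇒z∈S {z} e·z⁻¹∈S =
      subst (_∈ S) (⁻¹-involutive z) (S⁻¹⊆S (z ⁻¹) (subst (_∈ S) (identityˡ (z ⁻¹)) e·z⁻¹∈S))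
    Ne⊆S : N (Cay G S) e ⊆ S
    Ne⊆S {z} z∈Ne = e·z⁻¹∈S⇒z∈S (lookup⇒[]= (e · (z ⁻¹)) S (∈N⇒Adj (Cay G S) z∈Ne))
    S⊆Ne : S ⊆ N (Cay G S) e
    S⊆Ne {z} z∈S = Adj⇒∈N (Cay G S)
      ([]=⇒lookup (subst (_∈ S) (sym (identityˡ (z ⁻¹))) (S⁻¹⊆S z z∈S)))

  rightTranslation : Fin n → Permutation′ n
  rightTranslation y = permutation (_· y) (_· (y ⁻¹)) (//-rightDividesˡ y) (//-rightDividesʳ y)

  rightTranslation-automorphism : ∀ y → IsAutomorphism (Cay G S) (rightTranslation y)
  rightTranslation-automorphism y x z = cong (lookup S) (begin
    (x · y) · ((z · y) ⁻¹)       ≡⟨ cong ((x · y) ·_) (⁻¹-anti-homo-∙ z y) ⟩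
    (x · y) · ((y ⁻¹) · (z ⁻¹))  ≡⟨ assoc (x · y) (y ⁻¹) (z ⁻¹) ⟨
    ((x · y) · (y ⁻¹)) · (z ⁻¹)  ≡⟨ cong (_· (z ⁻¹)) (//-rightDividesʳ y x) ⟩
    x · (z ⁻¹)                   ∎)
    where open ≡-Reasoning

  ∣N∩N∣-Cay-translate : ∀ x y
    → ∣ N (Cay G S) x ∩ N (Cay G S) y ∣ ≡ ∣ N (Cay G S) (x · (y ⁻¹)) ∩ N (Cay G S) e ∣
  ∣N∩N∣-Cay-translate x y =
    trans (cong₂ (λ u v → ∣ N (Cay G S) u ∩ N (Cay G S) v ∣)
                 (sym (//-rightDividesˡ y x)) (sym (identityˡ y)))
          (∣N∩N∣-automorphism (Cay G S) (rightTranslation y) (rightTranslation-automorphism y)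
                              (x · (y ⁻¹)) e)

  ∉S∪e⇒≢e : ∀ {g} → g ∉ S ∪ ⁅ e ⁆ → g ≢ e
  ∉S∪e⇒≢e g∉S∪e refl = g∉S∪e (x∈p∪q⁺ (inj₂ (x∈⁅x⁆ e)))

  ∉S∪e⇒≁e : ∀ {g} → g ∉ S ∪ ⁅ e ⁆ → ¬ Adj (Cay G S) g e
  ∉S∪e⇒≁e {g} g∉S∪e g∼e =
    g∉S∪e (x∈p∪q⁺ (inj₁ (lookup⇒[]= g S (trans (sym (Cay-adj-e g)) g∼e))))

  ≢∧≁⇒x·y⁻¹∉S∪e : ∀ {x y} → x ≢ y → ¬ Adj (Cay G S) x y → x · (y ⁻¹) ∉ S ∪ ⁅ e ⁆
  ≢∧≁⇒x·y⁻¹∉S∪e {x} {y} x≢y x≁y x·y⁻¹∈S∪e =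
    [ x≁y ∘ []=⇒lookup , x≢y ∘ x∙y⁻¹≈ε⇒x≈y x y ∘ x∈⁅y⁆⇒x≡y e ]′ (x∈p∪q⁻ S ⁅ e ⁆ x·y⁻¹∈S∪e)

  ∣N∩N[e]∣≡nexus+∣N∩[S─C]∣ : ∀ {C a g} → (∀ s → s ∈ S → s ⁻¹ ∈ S)
    → IsRegularClique (Cay G S) C a → e ∈ C → g ∉ S ∪ ⁅ e ⁆
    → ∣ N (Cay G S) g ∩ N (Cay G S) e ∣ ≡ a + ∣ N (Cay G S) g ∩ (S ─ C) ∣
  ∣N∩N[e]∣≡nexus+∣N∩[S─C]∣ {C} {a} {g} S⁻¹⊆S regular e∈C g∉S∪e =
    trans (∣N∩N∣≡nexus+∣N∩[N─C]∣ (Cay G S) regular e∈C (∉S∪e⇒≢e g∉S∪e) (∉S∪e⇒≁e g∉S∪e))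
          (cong (λ q → a + ∣ N (Cay G S) g ∩ (q ─ C) ∣) (N-Cay-e S⁻¹⊆S))

theorem3p1 : (n : ℕ) (G : FinGroup n) (S : Subset n)
    → FinGroup.e G ∉ S
    → (∀ s → s ∈ S → FinGroup._⁻¹ G s ∈ S)
    → (k l a c : ℕ) (C : Subset n)
    → ¬ IsComplete (Cay G S)
    → IsEdgeRegular (Cay G S) k l
    → IsRegularClique (Cay G S) C a
    → FinGroup.e G ∈ C
    → ∣ C ∣ ≡ c
    → IsStronglyRegular (Cay G S)
      ⇔ (∃ λ m → ∀ x → x ∉ (S ∪ ⁅ FinGroup.e G ⁆)
                   → ∣ N (Cay G S) x ∩ (S ─ C) ∣ ≡ m)
theorem3p1 _ G S _ S⁻¹⊆S k l a _ C _ (k-regular , λ-regular) regular e∈C _ = mk⇔ to from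
  where
  open FinGroup G using (e; _·_; _⁻¹)
  μ-formula : ∀ {g} → g ∉ S ∪ ⁅ e ⁆
    → ∣ N (Cay G S) g ∩ N (Cay G S) e ∣ ≡ a + ∣ N (Cay G S) g ∩ (S ─ C) ∣
  μ-formula = ∣N∩N[e]∣≡nexus+∣N∩[S─C]∣ G S S⁻¹⊆S regular e∈C

  UniformOutside : Set
  UniformOutside = ∃ λ m → ∀ x → x ∉ S ∪ ⁅ e ⁆ → ∣ N (Cay G S) x ∩ (S ─ C) ∣ ≡ m

  to : IsStronglyRegular (Cay G S) → UniformOutside
  to (_ , _ , μ , _ , _ , μ-regular) = μ ∸ a , λ x x∉S∪e →
    trans (sym (m+n∸m≡n a _))
          (cong (_∸ a) (trans (sym (μ-formula x∉S∪e))
                              (μ-regular x e (∉S∪e⇒≢e G S x∉S∪e) (∉S∪e⇒≁e G S x∉S∪e))))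

  from : UniformOutside → IsStronglyRegular (Cay G S)
  from (m , constant) = k , l , a + m , k-regular , λ-regular , λ x y x≢y x≁y →
    let g∉S∪e = ≢∧≁⇒x·y⁻¹∉S∪e G S x≢y x≁y
    in trans (∣N∩N∣-Cay-translate G S x y)
             (trans (μ-formula g∉S∪e) (cong (a +_) (constant (x · (y ⁻¹)) g∉S∪e)))
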